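{- Given $r,\ell\in\mathbb{N}$ with $r\ge\ell\ge\frac r2\ge2$ and constants $\varepsilon,\mu,\delta$ with $0<4\varepsilon<\mu<1$ and $0<\delta<1$, there exist $\alpha,\gamma$ with $0<\alpha<\gamma$ such that the following holds for sufficiently large $n$. Let $G$ be an $n$-vertex graph with $\alpha_\ell(G)\le\alpha n$ and let $(V_i,V_j)$ be an $\varepsilon$-regular pair of disjoint vertex sets in $G$ with $|V_i|=|V_j|\ge\delta n$. If $d(V_i,V_j)\ge\frac{r-\ell}{\ell}+\mu$, then for each $x\in\{0,1\}$ there exists a family $\mathcal{K}_x$ of at least $\gamma n$ pairwise vertex-disjoint copies of $K_r$ in $G$ such that every $K\in\mathcal{K}_x$ satisfies $|V(K)\cap V_i|=r-\ell+x$ and $|V(K)\cap V_j|=\ell-x$.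
   Context: For a graph $G$, $\alpha_\ell(G)$ is the maximum number of vertices of an induced subgraph containing no copy of $K_\ell$. For disjoint vertex sets $X,Y$, $d(X,Y)=e(X,Y)/(|X||Y|)$ where $e(X,Y)$ is the number of edges between $X$ and $Y$; $(X,Y)$ is $\varepsilon$-regular if for all $X'\subseteq X$, $Y'\subseteq Y$ with $|X'|\ge\varepsilon|X|$ and $|Y'|\ge\varepsilon|Y|$ one has $|d(X',Y')-d(X,Y)|\le\varepsilon$.
   Formalization: The constants ε, μ and δ range only over the rationals, and the constants α and γ are taken in the rationals. -}

module Defs where

open import Data.Nat as ℕ using (ℕ; zero; suc; _∸_)
open import Data.Bool using (Bool; true; false; _∧_; if_then_else_)
open import Data.Fin using (Fin)
open import Data.Fin.Subset using (Subset; _∈_; _∉_; _⊆_; ∣_∣; _∩_)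
open import Data.Vec using (lookup)
open import Data.List using (List; map; allFin)
open import Data.Nat.ListAction using (sum)
open import Data.Integer using (+_)
open import Data.Rational as Q using (ℚ)
open import Data.Product using (_×_)
open import Relation.Binary.PropositionalEquality using (_≡_; _≢_)
open import Relation.Nullary using (¬_)

record Graph (n : ℕ) : Set where
  field
    adj    : Fin n → Fin n → Bool
    sym    : ∀ u v → adj u v ≡ adj v u
    irrefl : ∀ u → adj u u ≡ false
open Graph public

Edge : ∀ {n} → Graph n → Fin n → Fin n → Set
Edge G u v = adj G u v ≡ true

-- natural numbers as rationals, and a / b (with a / 0 := 0)
ℕtoℚ : ℕ → ℚ
ℕtoℚ a = (+ a) Q./ 1

ratio : ℕ → ℕ → ℚ
ratio a zero    = Q.0ℚ
ratio a (suc b) = (+ a) Q./ suc b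

eCount : ∀ {n} → Graph n → Subset n → Subset n → ℕ
eCount {n} G X Y =
  sum (map (λ u → sum (map (λ v →
        if lookup X u ∧ lookup Y v ∧ adj G u v then 1 else 0)
      (allFin n))) (allFin n))

density : ∀ {n} → Graph n → Subset n → Subset n → ℚ
density G X Y = ratio (eCount G X Y) (∣ X ∣ ℕ.* ∣ Y ∣)

Disjoint : ∀ {n} → Subset n → Subset n → Set
Disjoint X Y = ∀ {v} → v ∈ X → v ∉ Y

IsRegular : ∀ {n} → Graph n → ℚ → Subset n → Subset n → Set
IsRegular G ε X Y =
  ∀ X' Y' → X' ⊆ X → Y' ⊆ Y →
  ε Q.* ℕtoℚ ∣ X ∣ Q.≤ ℕtoℚ ∣ X' ∣ →
  ε Q.* ℕtoℚ ∣ Y ∣ Q.≤ ℕtoℚ ∣ Y' ∣ →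
  Q.∣ density G X' Y' Q.- density G X Y ∣ Q.≤ ε

IsKr : ∀ {n} → Graph n → ℕ → Subset n → Set
IsKr G r K = (∣ K ∣ ≡ r) × (∀ u v → u ∈ K → v ∈ K → u ≢ v → Edge G u v)

KFree : ∀ {n} → Graph n → ℕ → Subset n → Set
KFree G ℓ S = ∀ K → K ⊆ S → ¬ IsKr G ℓ K

-- α_ℓ(G) ≤ a, i.e. every K_ℓ-free induced subgraph has at most a vertices
AlphaAtMost : ∀ {n} → Graph n → ℕ → ℚ → Set
AlphaAtMost G ℓ a = ∀ S → KFree G ℓ S → ℕtoℚ ∣ S ∣ Q.≤ a

-- Write R = r − ℓ and m = |Vi| = |Vj|. Since d(Vi, Vj) exceeds R/ℓ by a fixed amount, linearly many
-- vertices of Vi have more than (R + η)m/ℓ neighbours in Vj, for a fixed η > 0. If U is a set of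
-- used vertices of small linear size, the high-degree vertices outside U still form a set too large
-- to be K_ℓ-free, so they contain a K_ℓ, C. Double counting the edges between C and Vj shows that
-- linearly many w ∈ Vj ∖ U have more than R neighbours in C; by pigeonhole over the subsets of C, a
-- 2^(−ℓ) fraction T′ of them have R + x common neighbours S ⊆ C. T′ is again too large to be
-- K_ℓ-free, and ℓ − x vertices Q of a K_ℓ inside T′ give the copy S ∪ Q of K_r. Repeating with U
-- the union of the copies found so far yields linearly many disjoint copies.

module Submission where

open import Defs hiding (sym)
open import Data.Nat
  using (ℕ; zero; suc; _+_; _*_; _∸_; _^_; _≤_; _<_; _≤?_; _<ᵇ_; z≤n; s≤s; NonZero; >-nonZero; >-nonZero⁻¹)
open import Data.Nat.Properties
open import Data.Nat.DivMod using (_/_; _%_; m≡m%n+[m/n]*n; m%n<n; m/n*n≤m)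
open import Data.Nat.Tactic.RingSolver using (solve-∀)
open import Algebra.Properties.CommutativeSemigroup *-commutativeSemigroup using (x∙yz≈y∙xz)
open import Data.Nat.ListAction as ListAction using ()
open import Data.Bool using (Bool; true; false; _∧_; if_then_else_)
import Data.Bool as Bool
open import Data.Bool.Properties using (T-≡; ∧-zeroʳ)
open import Data.Fin as Fin using (Fin; zero; suc)
open import Data.Fin.Properties using (all?)
open import Data.Fin.Subset using (Subset; inside; outside; _∈_; _∉_; _⊆_; _∩_; _∪_; ∁; ⊥; ⋃; ∣_∣; Nonempty)
open import Data.Fin.Subset.Properties
open import Data.Vec as Vec using ([]; _∷_; lookup; tabulate; here; there)
open import Data.Vec.Properties using (lookup∘tabulate; lookup-zipWith; []=⇒lookup; lookup⇒[]=)
open import Data.List as List using (List; []; _∷_; length)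
import Data.List.Properties as List
open import Data.List.Relation.Unary.All using (All; []; _∷_)
open import Data.List.Relation.Unary.AllPairs using (AllPairs; []; _∷_)
open import Algebra.Properties.Semiring.Sum +-*-semiring
  using (sum; sum-syntax; ∑-distrib-+; ∑-comm; *-distribˡ-sum; *-distribʳ-sum; sum-cong-≗)
import Data.Integer as ℤ
open import Data.Integer.Properties using (pos-*; pos-+; drop‿+≤+; +◃n≡+n)
open import Data.Rational as Q using (ℚ; mkℚ; 0ℚ; 1ℚ; toℚᵘ; ↧ₙ_)
import Data.Rational.Properties as ℚ
open import Data.Rational.Properties
  using (toℚᵘ-mono-≤; toℚᵘ-cancel-≤; toℚᵘ-cancel-<; toℚᵘ-fromℚᵘ; toℚᵘ-homo-*; toℚᵘ-homo-+)
open import Data.Rational.Unnormalised using (mkℚᵘ; *≤*; *<*)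
  renaming (_≃_ to _≃ᵘ_; _≤_ to _≤ᵘ_; _<_ to _<ᵘ_)
import Data.Rational.Unnormalised.Properties as ℚᵘ
open import Data.Product using (Σ; ∃; _×_; _,_; proj₁; proj₂)
open import Data.Sum using (inj₁; inj₂)
open import Data.Empty using (⊥-elim)
open import Function using (_∘_; Equivalence)
open import Relation.Nullary using (¬_; Dec; yes; no; contradiction; ¬?; _×-dec_; _→-dec_)
open import Relation.Binary.PropositionalEquality
  using (_≡_; _≢_; refl; sym; trans; cong; cong₂; subst; subst₂; module ≡-Reasoning)

𝟙 : Bool → ℕ
𝟙 b = if b then 1 else 0

𝟙-∧ : ∀ a b → 𝟙 (a ∧ b) ≡ 𝟙 a * 𝟙 b
𝟙-∧ true  b = sym (*-identityˡ (𝟙 b))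
𝟙-∧ false b = refl

sum-mono-≤ : ∀ {n} {f g : Fin n → ℕ} → (∀ i → f i ≤ g i) → sum f ≤ sum g
sum-mono-≤ {zero}  f≤g = z≤n
sum-mono-≤ {suc n} f≤g = +-mono-≤ (f≤g zero) (sum-mono-≤ (f≤g ∘ suc))

sum-map-allFin : ∀ {n} (f : Fin n → ℕ) → ListAction.sum (List.map f (List.allFin n)) ≡ sum f
sum-map-allFin {n} f = trans (cong ListAction.sum (List.map-tabulate (λ i → i) f)) (sum-tabulate f)
  where
  sum-tabulate : ∀ {n} (f : Fin n → ℕ) → ListAction.sum (List.tabulate f) ≡ sum f
  sum-tabulate {zero}  f = refl
  sum-tabulate {suc n} f = cong (f _ +_) (sum-tabulate (f ∘ suc))

∈-tabulate⁺ : ∀ {n} {f : Fin n → Bool} {v} → f v ≡ true → v ∈ tabulate f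
∈-tabulate⁺ {f = f} {v} fv = lookup⇒[]= v (tabulate f) (trans (lookup∘tabulate f v) fv)

∈-tabulate⁻ : ∀ {n} {f : Fin n → Bool} {v} → v ∈ tabulate f → f v ≡ true
∈-tabulate⁻ {f = f} {v} v∈ = trans (sym (lookup∘tabulate f v)) ([]=⇒lookup v∈)

𝟙-∈ : ∀ {n} {p : Subset n} {v} → v ∈ p → 𝟙 (lookup p v) ≡ 1
𝟙-∈ v∈p rewrite []=⇒lookup v∈p = refl

𝟙-∉ : ∀ {n} {p : Subset n} {v} → v ∉ p → 𝟙 (lookup p v) ≡ 0
𝟙-∉ {p = p} {v} v∉p with lookup p v in p[v]
... | true  = contradiction (lookup⇒[]= v p p[v]) v∉p
... | false = refl

∣p∣≡∑𝟙 : ∀ {n} (p : Subset n) → ∣ p ∣ ≡ ∑[ v < n ] 𝟙 (lookup p v)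
∣p∣≡∑𝟙 []            = refl
∣p∣≡∑𝟙 (inside  ∷ p) = cong suc (∣p∣≡∑𝟙 p)
∣p∣≡∑𝟙 (outside ∷ p) = ∣p∣≡∑𝟙 p

∣p∪q∣≤∣p∣+∣q∣ : ∀ {n} (p q : Subset n) → ∣ p ∪ q ∣ ≤ ∣ p ∣ + ∣ q ∣
∣p∪q∣≤∣p∣+∣q∣ []            []            = z≤n
∣p∪q∣≤∣p∣+∣q∣ (inside  ∷ p) (s       ∷ q) =
  s≤s (≤-trans (∣p∪q∣≤∣p∣+∣q∣ p q) (+-monoʳ-≤ ∣ p ∣ (∣p∣≤∣x∷p∣ s q)))
∣p∪q∣≤∣p∣+∣q∣ (outside ∷ p) (inside  ∷ q) =
  ≤-trans (s≤s (∣p∪q∣≤∣p∣+∣q∣ p q)) (≤-reflexive (sym (+-suc ∣ p ∣ ∣ q ∣)))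
∣p∪q∣≤∣p∣+∣q∣ (outside ∷ p) (outside ∷ q) = ∣p∪q∣≤∣p∣+∣q∣ p q

drop-∷-Disjoint : ∀ {n s t} {p q : Subset n} → Disjoint (s ∷ p) (t ∷ q) → Disjoint p q
drop-∷-Disjoint s∷p#t∷q v∈p v∈q = s∷p#t∷q (there v∈p) (there v∈q)

∣p∪q∣≡∣p∣+∣q∣ : ∀ {n} (p q : Subset n) → Disjoint p q → ∣ p ∪ q ∣ ≡ ∣ p ∣ + ∣ q ∣
∣p∪q∣≡∣p∣+∣q∣ []            []            _   = refl
∣p∪q∣≡∣p∣+∣q∣ (inside  ∷ p) (inside  ∷ q) p#q = contradiction here (p#q here)
∣p∪q∣≡∣p∣+∣q∣ (inside  ∷ p) (outside ∷ q) p#q = cong suc (∣p∪q∣≡∣p∣+∣q∣ p q (drop-∷-Disjoint p#q))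
∣p∪q∣≡∣p∣+∣q∣ (outside ∷ p) (inside  ∷ q) p#q =
  trans (cong suc (∣p∪q∣≡∣p∣+∣q∣ p q (drop-∷-Disjoint p#q))) (sym (+-suc ∣ p ∣ ∣ q ∣))
∣p∪q∣≡∣p∣+∣q∣ (outside ∷ p) (outside ∷ q) p#q = ∣p∪q∣≡∣p∣+∣q∣ p q (drop-∷-Disjoint p#q)

∣p∣≡∣p∩q∣+∣p∩∁q∣ : ∀ {n} (p q : Subset n) → ∣ p ∣ ≡ ∣ p ∩ q ∣ + ∣ p ∩ ∁ q ∣
∣p∣≡∣p∩q∣+∣p∩∁q∣ []            []            = refl
∣p∣≡∣p∩q∣+∣p∩∁q∣ (inside  ∷ p) (inside  ∷ q) = cong suc (∣p∣≡∣p∩q∣+∣p∩∁q∣ p q)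
∣p∣≡∣p∩q∣+∣p∩∁q∣ (inside  ∷ p) (outside ∷ q) =
  trans (cong suc (∣p∣≡∣p∩q∣+∣p∩∁q∣ p q)) (sym (+-suc ∣ p ∩ q ∣ ∣ p ∩ ∁ q ∣))
∣p∣≡∣p∩q∣+∣p∩∁q∣ (outside ∷ p) (s       ∷ q) = ∣p∣≡∣p∩q∣+∣p∩∁q∣ p q

∣p∣≤∣p∩∁q∣+∣q∣ : ∀ {n} (p q : Subset n) → ∣ p ∣ ≤ ∣ p ∩ ∁ q ∣ + ∣ q ∣
∣p∣≤∣p∩∁q∣+∣q∣ p q = begin
  ∣ p ∣                   ≡⟨ ∣p∣≡∣p∩q∣+∣p∩∁q∣ p q ⟩
  ∣ p ∩ q ∣ + ∣ p ∩ ∁ q ∣ ≤⟨ +-monoˡ-≤ ∣ p ∩ ∁ q ∣ (∣p∩q∣≤∣q∣ p q) ⟩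
  ∣ q ∣ + ∣ p ∩ ∁ q ∣     ≡⟨ +-comm ∣ q ∣ ∣ p ∩ ∁ q ∣ ⟩
  ∣ p ∩ ∁ q ∣ + ∣ q ∣     ∎
  where open ≤-Reasoning

∣p∣≤2*∣p∩q∣ : ∀ {n} (p q : Subset n) → ∣ p ∩ ∁ q ∣ ≤ ∣ p ∩ q ∣ → ∣ p ∣ ≤ 2 * ∣ p ∩ q ∣
∣p∣≤2*∣p∩q∣ p q ∣p∩∁q∣≤∣p∩q∣ = begin
  ∣ p ∣                   ≡⟨ ∣p∣≡∣p∩q∣+∣p∩∁q∣ p q ⟩
  ∣ p ∩ q ∣ + ∣ p ∩ ∁ q ∣ ≤⟨ +-monoʳ-≤ ∣ p ∩ q ∣ (≤-trans ∣p∩∁q∣≤∣p∩q∣ (m≤m+n _ 0)) ⟩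
  2 * ∣ p ∩ q ∣           ∎
  where open ≤-Reasoning

∣p∣≤2*∣p∩∁q∣ : ∀ {n} (p q : Subset n) → ∣ p ∩ q ∣ ≤ ∣ p ∩ ∁ q ∣ → ∣ p ∣ ≤ 2 * ∣ p ∩ ∁ q ∣
∣p∣≤2*∣p∩∁q∣ p q ∣p∩q∣≤∣p∩∁q∣ = begin
  ∣ p ∣                   ≡⟨ ∣p∣≡∣p∩q∣+∣p∩∁q∣ p q ⟩
  ∣ p ∩ q ∣ + ∣ p ∩ ∁ q ∣ ≤⟨ +-monoˡ-≤ ∣ p ∩ ∁ q ∣ ∣p∩q∣≤∣p∩∁q∣ ⟩
  ∣ p ∩ ∁ q ∣ + ∣ p ∩ ∁ q ∣ ≡⟨ cong (∣ p ∩ ∁ q ∣ +_) (+-identityʳ _) ⟨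
  2 * ∣ p ∩ ∁ q ∣         ∎
  where open ≤-Reasoning

∩-monoˡ-⊆ : ∀ {n} {p q r : Subset n} → p ⊆ q → p ∩ r ⊆ q ∩ r
∩-monoˡ-⊆ {p = p} {r = r} p⊆q v∈p∩r with x∈p∩q⁻ p r v∈p∩r
... | v∈p , v∈r = x∈p∩q⁺ (p⊆q v∈p , v∈r)

0<∣p∣⇒Nonempty : ∀ {n} (p : Subset n) → 0 < ∣ p ∣ → Nonempty p
0<∣p∣⇒Nonempty (inside  ∷ p) _   = zero , here
0<∣p∣⇒Nonempty (outside ∷ p) 0<∣p∣ with 0<∣p∣⇒Nonempty p 0<∣p∣
... | v , v∈p = suc v , there v∈p

⊆-ofSize : ∀ {n} (p : Subset n) {k} → k ≤ ∣ p ∣ → ∃ λ q → q ⊆ p × ∣ q ∣ ≡ k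
⊆-ofSize {n} p {zero} _ = ⊥ , ⊥⊆ , ∣⊥∣≡0 n
⊆-ofSize (inside ∷ p) {suc k} (s≤s k≤∣p∣) with ⊆-ofSize p k≤∣p∣
... | q , q⊆p , ∣q∣≡k = inside ∷ q , in⊆in q⊆p , cong suc ∣q∣≡k
⊆-ofSize (outside ∷ p) {suc k} k<∣p∣ with ⊆-ofSize p k<∣p∣
... | q , q⊆p , ∣q∣≡k = outside ∷ q , s⊆s q⊆p , ∣q∣≡k

sumOver : ∀ {n} → Subset n → (Fin n → ℕ) → ℕ
sumOver {n} X f = ∑[ v < n ] (𝟙 (lookup X v) * f v)

syntax sumOver X (λ v → e) = ∑[ v ∈ X ] e

sumOver-mono-≤ : ∀ {n} (X : Subset n) {f g : Fin n → ℕ} →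
  (∀ {v} → v ∈ X → f v ≤ g v) → ∑[ v ∈ X ] f v ≤ ∑[ v ∈ X ] g v
sumOver-mono-≤ X {f} {g} f≤g = sum-mono-≤ pointwise
  where
  pointwise : ∀ v → 𝟙 (lookup X v) * f v ≤ 𝟙 (lookup X v) * g v
  pointwise v with lookup X v in X[v]
  ... | true  = +-monoˡ-≤ 0 (f≤g (lookup⇒[]= v X X[v]))
  ... | false = z≤n

sumOver-const : ∀ {n} (X : Subset n) c → ∑[ v ∈ X ] c ≡ ∣ X ∣ * c
sumOver-const {n} X c = begin
  ∑[ v < n ] (𝟙 (lookup X v) * c) ≡⟨ *-distribʳ-sum c (λ v → 𝟙 (lookup X v)) ⟨
  (∑[ v < n ] 𝟙 (lookup X v)) * c ≡⟨ cong (_* c) (∣p∣≡∑𝟙 X) ⟨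
  ∣ X ∣ * c                       ∎
  where open ≡-Reasoning

*-distribˡ-sumOver : ∀ {n} (X : Subset n) c (f : Fin n → ℕ) →
  c * (∑[ v ∈ X ] f v) ≡ ∑[ v ∈ X ] (c * f v)
*-distribˡ-sumOver X c f = trans (*-distribˡ-sum c (λ v → 𝟙 (lookup X v) * f v))
  (sum-cong-≗ (λ v → x∙yz≈y∙xz c (𝟙 (lookup X v)) (f v)))

above : ∀ {n} → ℕ → (Fin n → ℕ) → Subset n
above t f = tabulate (λ v → t <ᵇ f v)

∈above⁺ : ∀ {n} {t} {f : Fin n → ℕ} {v} → t < f v → v ∈ above t f
∈above⁺ t<fv = ∈-tabulate⁺ (Equivalence.to T-≡ (<⇒<ᵇ t<fv))

∈above⁻ : ∀ {n} {t} {f : Fin n → ℕ} {v} → v ∈ above t f → t < f v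
∈above⁻ v∈ = <ᵇ⇒< _ _ (Equivalence.from T-≡ (∈-tabulate⁻ v∈))

sumOver-≤-above : ∀ {n} (X : Subset n) (f : Fin n → ℕ) {M} t → (∀ {v} → v ∈ X → f v ≤ M) →
  ∑[ v ∈ X ] f v ≤ M * ∣ X ∩ above t f ∣ + t * ∣ X ∣
sumOver-≤-above {n} X f {M} t f≤M = begin
  ∑[ v ∈ X ] f v
    ≤⟨ sum-mono-≤ pointwise ⟩
  ∑[ v < n ] (M * 𝟙 (lookup (X ∩ above t f) v) + t * 𝟙 (lookup X v))
    ≡⟨ ∑-distrib-+ (λ v → M * 𝟙 (lookup (X ∩ above t f) v)) (λ v → t * 𝟙 (lookup X v)) ⟩
  ∑[ v < n ] (M * 𝟙 (lookup (X ∩ above t f) v)) + ∑[ v < n ] (t * 𝟙 (lookup X v))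
    ≡⟨ cong₂ _+_ (*-distribˡ-sum M (λ v → 𝟙 (lookup (X ∩ above t f) v))) (*-distribˡ-sum t (λ v → 𝟙 (lookup X v))) ⟨
  M * ∑[ v < n ] 𝟙 (lookup (X ∩ above t f) v) + t * ∑[ v < n ] 𝟙 (lookup X v)
    ≡⟨ cong₂ (λ a b → M * a + t * b) (∣p∣≡∑𝟙 (X ∩ above t f)) (∣p∣≡∑𝟙 X) ⟨
  M * ∣ X ∩ above t f ∣ + t * ∣ X ∣
    ∎
  where
  open ≤-Reasoning
  pointwise : ∀ v → 𝟙 (lookup X v) * f v ≤ M * 𝟙 (lookup (X ∩ above t f) v) + t * 𝟙 (lookup X v)
  pointwise v with v ∈? X
  ... | no v∉X rewrite 𝟙-∉ v∉X = z≤n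
  ... | yes v∈X with t <? f v
  ...   | yes t<fv rewrite 𝟙-∈ v∈X | 𝟙-∈ (x∈p∩q⁺ (v∈X , ∈above⁺ {f = f} t<fv)) | *-identityʳ M | *-identityʳ t =
    ≤-trans (≤-reflexive (+-identityʳ (f v))) (≤-trans (f≤M v∈X) (m≤m+n M t))
  ...   | no t≮fv rewrite 𝟙-∈ v∈X | 𝟙-∉ (t≮fv ∘ ∈above⁻ {f = f} ∘ proj₂ ∘ x∈p∩q⁻ X (above t f))
                        | *-zeroʳ M | *-identityʳ t =
    ≤-trans (≤-reflexive (+-identityʳ (f v))) (≮⇒≥ t≮fv)

N : ∀ {n} → Graph n → Fin n → Subset n
N G u = tabulate (adj G u)

eCount≡∑∑ : ∀ {n} (G : Graph n) (X Y : Subset n) →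
  eCount G X Y ≡ ∑[ u < n ] ∑[ v < n ] 𝟙 (lookup X u ∧ (lookup Y v ∧ adj G u v))
eCount≡∑∑ {n} G X Y = trans (sum-map-allFin row) (sum-cong-≗ (sum-map-allFin ∘ entry))
  where
  entry : Fin n → Fin n → ℕ
  entry u v = 𝟙 (lookup X u ∧ (lookup Y v ∧ adj G u v))
  row : Fin n → ℕ
  row u = ListAction.sum (List.map (entry u) (List.allFin n))

eCount≡∑∣∩N∣ : ∀ {n} (G : Graph n) (X Y : Subset n) → eCount G X Y ≡ ∑[ u ∈ X ] ∣ Y ∩ N G u ∣
eCount≡∑∣∩N∣ {n} G X Y = trans (eCount≡∑∑ G X Y) (sum-cong-≗ λ u → begin
  ∑[ v < n ] 𝟙 (lookup X u ∧ (lookup Y v ∧ adj G u v))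
    ≡⟨ sum-cong-≗ (λ v → 𝟙-∧ (lookup X u) (lookup Y v ∧ adj G u v)) ⟩
  ∑[ v < n ] (𝟙 (lookup X u) * 𝟙 (lookup Y v ∧ adj G u v))
    ≡⟨ *-distribˡ-sum (𝟙 (lookup X u)) (λ v → 𝟙 (lookup Y v ∧ adj G u v)) ⟨
  𝟙 (lookup X u) * ∑[ v < n ] 𝟙 (lookup Y v ∧ adj G u v)
    ≡⟨ cong (𝟙 (lookup X u) *_) (sum-cong-≗ lookup-Y∩N) ⟨
  𝟙 (lookup X u) * ∑[ v < n ] 𝟙 (lookup (Y ∩ N G u) v)
    ≡⟨ cong (𝟙 (lookup X u) *_) (∣p∣≡∑𝟙 (Y ∩ N G u)) ⟨
  𝟙 (lookup X u) * ∣ Y ∩ N G u ∣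
    ∎)
  where
  open ≡-Reasoning
  lookup-Y∩N : ∀ {u} v → 𝟙 (lookup (Y ∩ N G u) v) ≡ 𝟙 (lookup Y v ∧ adj G u v)
  lookup-Y∩N {u} v =
    cong 𝟙 (trans (lookup-zipWith _∧_ v Y (N G u)) (cong (lookup Y v ∧_) (lookup∘tabulate (adj G u) v)))

eCount-comm : ∀ {n} (G : Graph n) (X Y : Subset n) → eCount G X Y ≡ eCount G Y X
eCount-comm {n} G X Y = begin
  eCount G X Y
    ≡⟨ eCount≡∑∑ G X Y ⟩
  ∑[ u < n ] ∑[ v < n ] 𝟙 (lookup X u ∧ (lookup Y v ∧ adj G u v))
    ≡⟨ ∑-comm (λ u v → 𝟙 (lookup X u ∧ (lookup Y v ∧ adj G u v))) ⟩
  ∑[ v < n ] ∑[ u < n ] 𝟙 (lookup X u ∧ (lookup Y v ∧ adj G u v))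
    ≡⟨ sum-cong-≗ (λ v → sum-cong-≗ (λ u → cong 𝟙 (swap (lookup X u) (lookup Y v) (Graph.sym G u v)))) ⟩
  ∑[ v < n ] ∑[ u < n ] 𝟙 (lookup Y v ∧ (lookup X u ∧ adj G v u))
    ≡⟨ eCount≡∑∑ G Y X ⟨
  eCount G Y X
    ∎
  where
  open ≡-Reasoning
  swap : ∀ a b {c d} → c ≡ d → a ∧ (b ∧ c) ≡ b ∧ (a ∧ d)
  swap true  b refl = refl
  swap false b refl = sym (∧-zeroʳ b)

-- A common subset of many sets

module _ {m : ℕ} where

  tail-⊆ : ∀ {s} {p : Subset (suc m)} {q} → p ⊆ s ∷ q → Vec.tail p ⊆ q
  tail-⊆ {p = t ∷ p} = drop-∷-⊆

  outside∷⊆ : ∀ {S} {p : Subset (suc m)} → S ⊆ Vec.tail p → outside ∷ S ⊆ p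
  outside∷⊆ {p = t ∷ p} = out⊆

  inside∷⊆ : ∀ {S} {p : Subset (suc m)} → Vec.head p ≡ inside → S ⊆ Vec.tail p → inside ∷ S ⊆ p
  inside∷⊆ {p = inside ∷ p} refl = in⊆in

  ∣p∣≡𝟙head+∣tail∣ : ∀ (p : Subset (suc m)) {s} → Vec.head p ≡ s → ∣ p ∣ ≡ 𝟙 s + ∣ Vec.tail p ∣
  ∣p∣≡𝟙head+∣tail∣ (inside  ∷ p) refl = refl
  ∣p∣≡𝟙head+∣tail∣ (outside ∷ p) refl = refl

  head-outside : ∀ {p : Subset (suc m)} {q} → p ⊆ outside ∷ q → Vec.head p ≡ outside
  head-outside {p = inside  ∷ p} p⊆ with () ← p⊆ here
  head-outside {p = outside ∷ p} p⊆ = refl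

record CommonSubset {N m} (T : Subset N) (F : Fin N → Subset m) (C : Subset m) (k : ℕ) : Set where
  field
    S              : Subset m
    S⊆C            : S ⊆ C
    ∣S∣≡k          : ∣ S ∣ ≡ k
    T′             : Subset N
    T′⊆T           : T′ ⊆ T
    S⊆F            : ∀ {w} → w ∈ T′ → S ⊆ F w
    ∣T∣≤2^∣C∣*∣T′∣ : ∣ T ∣ ≤ 2 ^ ∣ C ∣ * ∣ T′ ∣

heads : ∀ {N m} → (Fin N → Subset (suc m)) → Subset N
heads F = tabulate (Vec.head ∘ F)

CommonSubset-∷ : ∀ {N m} {T T₀ : Subset N} {F : Fin N → Subset (suc m)} {C : Subset m} {k} s →
  T₀ ⊆ T → (∀ {w} → w ∈ T₀ → s ≡ inside → Vec.head (F w) ≡ inside) → ∣ T ∣ ≤ 2 * ∣ T₀ ∣ →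
  CommonSubset T₀ (Vec.tail ∘ F) C k → CommonSubset T F (inside ∷ C) (𝟙 s + k)
CommonSubset-∷ {T = T} {T₀} {C = C} s T₀⊆T head-inside ∣T∣≤2∣T₀∣ common = record
  { S              = s ∷ S
  ; S⊆C            = s∷S⊆inside∷C s
  ; ∣S∣≡k          = trans (∣p∣≡𝟙head+∣tail∣ (s ∷ S) refl) (cong (𝟙 s +_) ∣S∣≡k)
  ; T′             = T′
  ; T′⊆T           = T₀⊆T ∘ T′⊆T
  ; S⊆F            = λ w∈T′ → s∷S⊆F s (head-inside (T′⊆T w∈T′)) (S⊆F w∈T′)
  ; ∣T∣≤2^∣C∣*∣T′∣ = begin
      ∣ T ∣                    ≤⟨ ∣T∣≤2∣T₀∣ ⟩
      2 * ∣ T₀ ∣               ≤⟨ *-monoʳ-≤ 2 ∣T∣≤2^∣C∣*∣T′∣ ⟩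
      2 * (2 ^ ∣ C ∣ * ∣ T′ ∣) ≡⟨ *-assoc 2 (2 ^ ∣ C ∣) ∣ T′ ∣ ⟨
      2 * 2 ^ ∣ C ∣ * ∣ T′ ∣   ∎
  }
  where
  open ≤-Reasoning
  open CommonSubset common
  s∷S⊆inside∷C : ∀ s → s ∷ S ⊆ inside ∷ C
  s∷S⊆inside∷C inside  = in⊆in S⊆C
  s∷S⊆inside∷C outside = out⊆ S⊆C
  s∷S⊆F : ∀ {p : Subset _} s → (s ≡ inside → Vec.head p ≡ inside) → S ⊆ Vec.tail p → s ∷ S ⊆ p
  s∷S⊆F inside  head≡inside = inside∷⊆ (head≡inside refl)
  s∷S⊆F outside _           = outside∷⊆

-- Induction along C. At an element of C, T is split according to whether F w contains that
-- element; recursing into the larger half costs a factor 2.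
common-subset : ∀ {N m} (T : Subset N) (F : Fin N → Subset m) (C : Subset m) k →
  (∀ {w} → w ∈ T → F w ⊆ C) → (∀ {w} → w ∈ T → k ≤ ∣ F w ∣) → k ≤ ∣ C ∣ →
  CommonSubset T F C k
common-subset {m = m} T F C zero _ _ _ = record
  { S = ⊥ ; S⊆C = ⊥⊆ ; ∣S∣≡k = ∣⊥∣≡0 m ; T′ = T ; T′⊆T = λ w∈T → w∈T ; S⊆F = λ _ → ⊥⊆
  ; ∣T∣≤2^∣C∣*∣T′∣ = m≤n*m ∣ T ∣ (2 ^ ∣ C ∣) {{m^n≢0 2 ∣ C ∣}} }
common-subset T F (outside ∷ C) k@(suc _) F⊆C k≤∣F∣ k≤∣C∣ = record
  { S = outside ∷ S ; S⊆C = out⊆ S⊆C ; ∣S∣≡k = ∣S∣≡k ; T′ = T′ ; T′⊆T = T′⊆T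
  ; S⊆F = λ w∈T′ → outside∷⊆ (S⊆F w∈T′) ; ∣T∣≤2^∣C∣*∣T′∣ = ∣T∣≤2^∣C∣*∣T′∣ }
  where
  k≤∣tail∣ : ∀ {w} → w ∈ T → k ≤ ∣ Vec.tail (F w) ∣
  k≤∣tail∣ {w} w∈T = subst (k ≤_) (∣p∣≡𝟙head+∣tail∣ (F w) (head-outside (F⊆C w∈T))) (k≤∣F∣ w∈T)
  open CommonSubset (common-subset T (Vec.tail ∘ F) C k (tail-⊆ ∘ F⊆C) k≤∣tail∣ k≤∣C∣)
common-subset T F (inside ∷ C) (suc k) F⊆C k≤∣F∣ (s≤s k≤∣C∣)
  with ∣ T ∩ ∁ (heads F) ∣ ≤? ∣ T ∩ heads F ∣
... | yes fewer-outside = CommonSubset-∷ inside (proj₁ ∘ x∈p∩q⁻ T H) (λ w∈ _ → ∈-tabulate⁻ (proj₂ (x∈p∩q⁻ T H w∈)))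
        (∣p∣≤2*∣p∩q∣ T H fewer-outside)
        (common-subset (T ∩ H) (Vec.tail ∘ F) C k (tail-⊆ ∘ F⊆C ∘ proj₁ ∘ x∈p∩q⁻ T H) k≤∣tail∣ k≤∣C∣)
  where
  H = heads F
  k≤∣tail∣ : ∀ {w} → w ∈ T ∩ H → k ≤ ∣ Vec.tail (F w) ∣
  k≤∣tail∣ {w} w∈ with x∈p∩q⁻ T H w∈
  ... | w∈T , w∈H = ≤-pred (subst (suc k ≤_) (∣p∣≡𝟙head+∣tail∣ (F w) (∈-tabulate⁻ w∈H)) (k≤∣F∣ w∈T))
... | no fewer-inside = CommonSubset-∷ outside (proj₁ ∘ x∈p∩q⁻ T (∁ H)) (λ _ ())
        (∣p∣≤2*∣p∩∁q∣ T H (<⇒≤ (≰⇒> fewer-inside)))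
        (common-subset (T ∩ ∁ H) (Vec.tail ∘ F) C (suc k) (tail-⊆ ∘ F⊆C ∘ proj₁ ∘ x∈p∩q⁻ T (∁ H)) k<∣tail∣ k<∣C∣)
  where
  H = heads F
  k<∣tail∣ : ∀ {w} → w ∈ T ∩ ∁ H → suc k ≤ ∣ Vec.tail (F w) ∣
  k<∣tail∣ {w} w∈ with x∈p∩q⁻ T (∁ H) w∈
  ... | w∈T , w∈∁H with Vec.head (F w) in head≡
  ...   | inside  = contradiction (∈-tabulate⁺ head≡) (x∈∁p⇒x∉p w∈∁H)
  ...   | outside = subst (suc k ≤_) (∣p∣≡𝟙head+∣tail∣ (F w) head≡) (k≤∣F∣ w∈T)
  k<∣C∣ : suc k ≤ ∣ C ∣
  k<∣C∣ with 0<∣p∣⇒Nonempty (T ∩ ∁ H) (≤-<-trans z≤n (≰⇒> fewer-inside))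
  ... | w , w∈ = ≤-trans (k<∣tail∣ w∈) (p⊆q⇒∣p∣≤∣q∣ (tail-⊆ (F⊆C (proj₁ (x∈p∩q⁻ T (∁ H) w∈)))))

Clique : ∀ {n} → Graph n → Subset n → Set
Clique G K = ∀ u v → u ∈ K → v ∈ K → u ≢ v → Edge G u v

Clique-⊆ : ∀ {n} {G : Graph n} {K K′ : Subset n} → K′ ⊆ K → Clique G K → Clique G K′
Clique-⊆ K′⊆K clique u v u∈ v∈ = clique u v (K′⊆K u∈) (K′⊆K v∈)

Clique-∪ : ∀ {n} {G : Graph n} {S Q : Subset n} → Clique G S → Clique G Q →
  (∀ {u v} → u ∈ Q → v ∈ S → Edge G u v) → Clique G (S ∪ Q)
Clique-∪ {G = G} {S} {Q} S-clique Q-clique cross u v u∈ v∈ u≢v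
  with x∈p∪q⁻ S Q u∈ | x∈p∪q⁻ S Q v∈
... | inj₁ u∈S | inj₁ v∈S = S-clique u v u∈S v∈S u≢v
... | inj₂ u∈Q | inj₂ v∈Q = Q-clique u v u∈Q v∈Q u≢v
... | inj₁ u∈S | inj₂ v∈Q = trans (Graph.sym G u v) (cross v∈Q u∈S)
... | inj₂ u∈Q | inj₁ v∈S = cross u∈Q v∈S

IsKr? : ∀ {n} (G : Graph n) r K → Dec (IsKr G r K)
IsKr? G r K = (∣ K ∣ ≟ r) ×-dec all? λ u → all? λ v →
  u ∈? K →-dec v ∈? K →-dec ¬? (u Fin.≟ v) →-dec adj G u v Bool.≟ true

clique-in-nonfree : ∀ {n} (G : Graph n) ℓ S → ¬ KFree G ℓ S → ∃ λ K → K ⊆ S × IsKr G ℓ K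
clique-in-nonfree G ℓ S not-free with anySubset? (λ K → K ⊆? S ×-dec IsKr? G ℓ K)
... | yes found = found
... | no none    = ⊥-elim (not-free (λ K K⊆S K-clique → none (K , K⊆S , K-clique)))

∪-∩-absorb : ∀ {n} {p q s : Subset n} → p ⊆ s → Disjoint q s → (p ∪ q) ∩ s ≡ p
∪-∩-absorb {p = p} {q} {s} p⊆s q#s = ⊆-antisym ⊆p p⊆
  where
  ⊆p : (p ∪ q) ∩ s ⊆ p
  ⊆p {v} v∈ with x∈p∩q⁻ (p ∪ q) s v∈
  ... | v∈p∪q , v∈s with x∈p∪q⁻ p q v∈p∪q
  ...   | inj₁ v∈p = v∈p
  ...   | inj₂ v∈q = contradiction v∈s (q#s v∈q)
  p⊆ : p ⊆ (p ∪ q) ∩ s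
  p⊆ v∈p = x∈p∩q⁺ (p⊆p∪q q v∈p , p⊆s v∈p)

join-cliques : ∀ {n} {G : Graph n} {X Y S Q : Subset n} → Disjoint X Y → S ⊆ X → Q ⊆ Y →
  Clique G S → Clique G Q → (∀ {u v} → u ∈ Q → v ∈ S → Edge G u v) →
  IsKr G (∣ S ∣ + ∣ Q ∣) (S ∪ Q) × (S ∪ Q) ∩ X ≡ S × (S ∪ Q) ∩ Y ≡ Q
join-cliques {G = G} {X} {Y} {S} {Q} X#Y S⊆X Q⊆Y S-clique Q-clique cross =
  (∣p∪q∣≡∣p∣+∣q∣ S Q S#Q , Clique-∪ {G = G} S-clique Q-clique cross) ,
  ∪-∩-absorb S⊆X (λ v∈Q v∈X → X#Y v∈X (Q⊆Y v∈Q)) ,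
  trans (cong (_∩ Y) (∪-comm S Q)) (∪-∩-absorb Q⊆Y (λ v∈S → X#Y (S⊆X v∈S)))
  where
  S#Q : Disjoint S Q
  S#Q v∈S v∈Q = X#Y (S⊆X v∈S) (Q⊆Y v∈Q)

-- Many vertices of high degree

m*m≤k*m⇒m≤k : ∀ m k → m * m ≤ k * m → m ≤ k
m*m≤k*m⇒m≤k zero      k _ = z≤n
m*m≤k*m⇒m≤k m@(suc _) k   = *-cancelʳ-≤ m k m

many-high-degree : ∀ {n} (G : Graph n) (X Y : Subset n) {m} c ℓ R → ∣ X ∣ ≡ m → ∣ Y ∣ ≡ m →
  (c * R + 2) * (m * m) ≤ c * ℓ * eCount G X Y →
  m ≤ c * ℓ * ∣ X ∩ above ((c * R + 1) * m) (λ v → c * ℓ * ∣ Y ∩ N G v ∣) ∣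
many-high-degree G X Y {m} c ℓ R refl ∣Y∣≡m dense =
  m*m≤k*m⇒m≤k m (c * ℓ * ∣ H ∣) (+-cancelʳ-≤ ((c * R + 1) * (m * m)) (m * m) (c * ℓ * ∣ H ∣ * m) (begin
    m * m + (c * R + 1) * (m * m)            ≡⟨ split-square c R m ⟩
    (c * R + 2) * (m * m)                    ≤⟨ dense ⟩
    c * ℓ * eCount G X Y                     ≡⟨ cong (c * ℓ *_) (eCount≡∑∣∩N∣ G X Y) ⟩
    c * ℓ * (∑[ v ∈ X ] ∣ Y ∩ N G v ∣)       ≡⟨ *-distribˡ-sumOver X (c * ℓ) (λ v → ∣ Y ∩ N G v ∣) ⟩
    ∑[ v ∈ X ] (c * ℓ * ∣ Y ∩ N G v ∣)       ≤⟨ sumOver-≤-above X _ ((c * R + 1) * m) deg≤ ⟩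
    c * ℓ * m * ∣ H ∣ + (c * R + 1) * m * m  ≡⟨ regroup (c * ℓ) (c * R + 1) m ∣ H ∣ ⟩
    c * ℓ * ∣ H ∣ * m + (c * R + 1) * (m * m) ∎))
  where
  open ≤-Reasoning
  H = X ∩ above ((c * R + 1) * m) (λ v → c * ℓ * ∣ Y ∩ N G v ∣)
  deg≤ : ∀ {v} → v ∈ X → c * ℓ * ∣ Y ∩ N G v ∣ ≤ c * ℓ * m
  deg≤ _ = *-monoʳ-≤ (c * ℓ) (≤-trans (∣p∩q∣≤∣p∣ Y _) (≤-reflexive ∣Y∣≡m))
  split-square : ∀ c R m → m * m + (c * R + 1) * (m * m) ≡ (c * R + 2) * (m * m)
  split-square = solve-∀
  regroup : ∀ a b m h → a * m * h + b * m * m ≡ a * h * m + b * (m * m)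
  regroup = solve-∀

many-common-neighbours : ∀ {n} (G : Graph n) (Y C : Subset n) {m} c ℓ R .{{_ : NonZero ℓ}} →
  ∣ Y ∣ ≡ m → ∣ C ∣ ≡ ℓ → (∀ {v} → v ∈ C → (c * R + 1) * m < c * ℓ * ∣ Y ∩ N G v ∣) →
  m ≤ c * ℓ * ∣ Y ∩ above R (λ w → ∣ C ∩ N G w ∣) ∣
many-common-neighbours G Y C {m} c ℓ R ∣Y∣≡m refl C-high =
  *-cancelˡ-≤ ℓ (+-cancelʳ-≤ (c * ℓ * (R * m)) (ℓ * m) (ℓ * (c * ℓ * ∣ W ∣)) (begin
    ℓ * m + c * ℓ * (R * m)                  ≡⟨ expand-lhs c ℓ R m ⟩
    ∣ C ∣ * ((c * R + 1) * m)                ≡⟨ sumOver-const C ((c * R + 1) * m) ⟨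
    ∑[ v ∈ C ] ((c * R + 1) * m)             ≤⟨ sumOver-mono-≤ C (<⇒≤ ∘ C-high) ⟩
    ∑[ v ∈ C ] (c * ℓ * ∣ Y ∩ N G v ∣)       ≡⟨ *-distribˡ-sumOver C (c * ℓ) (λ v → ∣ Y ∩ N G v ∣) ⟨
    c * ℓ * (∑[ v ∈ C ] ∣ Y ∩ N G v ∣)       ≡⟨ cong (c * ℓ *_) (eCount≡∑∣∩N∣ G C Y) ⟨
    c * ℓ * eCount G C Y                     ≡⟨ cong (c * ℓ *_) (eCount-comm G C Y) ⟩
    c * ℓ * eCount G Y C                     ≡⟨ cong (c * ℓ *_) (eCount≡∑∣∩N∣ G Y C) ⟩
    c * ℓ * (∑[ w ∈ Y ] ∣ C ∩ N G w ∣)       ≤⟨ *-monoʳ-≤ (c * ℓ) (sumOver-≤-above Y (λ w → ∣ C ∩ N G w ∣) R ∣C∩N∣≤ℓ) ⟩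
    c * ℓ * (ℓ * ∣ W ∣ + R * ∣ Y ∣)          ≡⟨ cong (λ y → c * ℓ * (ℓ * ∣ W ∣ + R * y)) ∣Y∣≡m ⟩
    c * ℓ * (ℓ * ∣ W ∣ + R * m)              ≡⟨ expand-rhs c ℓ R m ∣ W ∣ ⟩
    ℓ * (c * ℓ * ∣ W ∣) + c * ℓ * (R * m)    ∎))
  where
  open ≤-Reasoning
  W = Y ∩ above R (λ w → ∣ C ∩ N G w ∣)
  ∣C∩N∣≤ℓ : ∀ {w} → w ∈ Y → ∣ C ∩ N G w ∣ ≤ ℓ
  ∣C∩N∣≤ℓ _ = ∣p∩q∣≤∣p∣ C _
  expand-lhs : ∀ c ℓ R m → ℓ * m + c * ℓ * (R * m) ≡ ℓ * ((c * R + 1) * m)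
  expand-lhs = solve-∀
  expand-rhs : ∀ c ℓ R m w → c * ℓ * (ℓ * w + R * m) ≡ ℓ * (c * ℓ * w) + c * ℓ * (R * m)
  expand-rhs = solve-∀

-- Greedy packing

module _ {n} {Good : Subset n → Set} {r} (size : ∀ {K} → Good K → ∣ K ∣ ≡ r) where

  ∣⋃∣≤r*length : ∀ 𝒦 → All Good 𝒦 → ∣ ⋃ 𝒦 ∣ ≤ r * length 𝒦
  ∣⋃∣≤r*length []      []             = ≤-reflexive (trans (∣⊥∣≡0 n) (sym (*-zeroʳ r)))
  ∣⋃∣≤r*length (K ∷ 𝒦) (good ∷ goods) = begin
    ∣ K ∪ ⋃ 𝒦 ∣           ≤⟨ ∣p∪q∣≤∣p∣+∣q∣ K (⋃ 𝒦) ⟩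
    ∣ K ∣ + ∣ ⋃ 𝒦 ∣       ≤⟨ +-mono-≤ (≤-reflexive (size good)) (∣⋃∣≤r*length 𝒦 goods) ⟩
    r + r * length 𝒦      ≡⟨ *-suc r (length 𝒦) ⟨
    r * suc (length 𝒦)    ∎
    where open ≤-Reasoning

  Disjoint-⋃ : ∀ {K : Subset n} 𝒦 → Disjoint K (⋃ 𝒦) → All (Disjoint K) 𝒦
  Disjoint-⋃ []       _    = []
  Disjoint-⋃ (K′ ∷ 𝒦) K#⋃ =
    (λ v∈K v∈K′ → K#⋃ v∈K (p⊆p∪q (⋃ 𝒦) v∈K′)) ∷ Disjoint-⋃ 𝒦 (λ v∈K v∈⋃ → K#⋃ v∈K (q⊆p∪q K′ (⋃ 𝒦) v∈⋃))

  greedy-family : ∀ g → (∀ U → ∣ U ∣ ≤ r * g → ∃ λ K → Disjoint K U × Good K) →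
    Σ (List (Subset n)) λ 𝒦 → length 𝒦 ≡ suc g × AllPairs Disjoint 𝒦 × All Good 𝒦
  greedy-family g avoid = family (suc g) ≤-refl
    where
    family : ∀ k → k ≤ suc g → Σ (List (Subset n)) λ 𝒦 → length 𝒦 ≡ k × AllPairs Disjoint 𝒦 × All Good 𝒦
    family zero    _       = [] , refl , [] , []
    family (suc k) k<suc-g with family k (≤-trans (n≤1+n k) k<suc-g)
    ... | 𝒦 , refl , disjoint , goods with avoid (⋃ 𝒦) (≤-trans (∣⋃∣≤r*length 𝒦 goods) (*-monoʳ-≤ r (≤-pred k<suc-g)))
    ...   | K , K#⋃𝒦 , good = K ∷ 𝒦 , refl , Disjoint-⋃ 𝒦 K#⋃𝒦 ∷ disjoint , good ∷ goods

-- From the rational hypotheses to natural numbers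

toℚᵘ-mono-≤-≃ : ∀ {p q p′ q′} → p Q.≤ q → toℚᵘ p ≃ᵘ p′ → toℚᵘ q ≃ᵘ q′ → p′ ≤ᵘ q′
toℚᵘ-mono-≤-≃ p≤q p≃ q≃ = ℚᵘ.≤-respʳ-≃ q≃ (ℚᵘ.≤-respˡ-≃ p≃ (toℚᵘ-mono-≤ p≤q))

toℚᵘ-cancel-≤-≃ : ∀ {p q p′ q′} → p′ ≤ᵘ q′ → toℚᵘ p ≃ᵘ p′ → toℚᵘ q ≃ᵘ q′ → p Q.≤ q
toℚᵘ-cancel-≤-≃ p′≤q′ p≃ q≃ = toℚᵘ-cancel-≤ (ℚᵘ.≤-respʳ-≃ (ℚᵘ.≃-sym q≃) (ℚᵘ.≤-respˡ-≃ (ℚᵘ.≃-sym p≃) p′≤q′))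

toℚᵘ-cancel-<-≃ : ∀ {p q p′ q′} → p′ <ᵘ q′ → toℚᵘ p ≃ᵘ p′ → toℚᵘ q ≃ᵘ q′ → p Q.< q
toℚᵘ-cancel-<-≃ p′<q′ p≃ q≃ = toℚᵘ-cancel-< (ℚᵘ.<-respʳ-≃ (ℚᵘ.≃-sym q≃) (ℚᵘ.<-respˡ-≃ (ℚᵘ.≃-sym p≃) p′<q′))

toℚᵘ-/suc : ∀ a d → toℚᵘ ((ℤ.+ a) Q./ suc d) ≃ᵘ mkℚᵘ (ℤ.+ a) d
toℚᵘ-/suc a d = toℚᵘ-fromℚᵘ (mkℚᵘ (ℤ.+ a) d)

+*+-mono-< : ∀ a b c d → a * b < c * d → (ℤ.+ a) ℤ.* (ℤ.+ b) ℤ.< (ℤ.+ c) ℤ.* (ℤ.+ d)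
+*+-mono-< a b c d h = subst₂ ℤ._<_ (pos-* a b) (pos-* c d) (ℤ.+<+ h)

+*+-mono-≤ : ∀ a b c d → a * b ≤ c * d → (ℤ.+ a) ℤ.* (ℤ.+ b) ℤ.≤ (ℤ.+ c) ℤ.* (ℤ.+ d)
+*+-mono-≤ a b c d h = subst₂ ℤ._≤_ (pos-* a b) (pos-* c d) (ℤ.+≤+ h)

+*+-cancel-≤ : ∀ a b c d → (ℤ.+ a) ℤ.* (ℤ.+ b) ℤ.≤ (ℤ.+ c) ℤ.* (ℤ.+ d) → a * b ≤ c * d
+*+-cancel-≤ a b c d h = drop‿+≤+ (subst₂ ℤ._≤_ (sym (pos-* a b)) (sym (pos-* c d)) h)

0<1/suc : ∀ k → 0ℚ Q.< (ℤ.+ 1) Q./ suc k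
0<1/suc k = toℚᵘ-cancel-<-≃ (*<* (+*+-mono-< 0 (suc k) 1 1 (s≤s z≤n))) ℚᵘ.≃-refl (toℚᵘ-/suc 1 k)

1/suc<2/suc : ∀ k → (ℤ.+ 1) Q./ suc k Q.< (ℤ.+ 2) Q./ suc k
1/suc<2/suc k = toℚᵘ-cancel-<-≃ (*<* (+*+-mono-< 1 (suc k) 2 (suc k) (*-monoˡ-< (suc k) (≤-refl {2}))))
  (toℚᵘ-/suc 1 k) (toℚᵘ-/suc 2 k)

δ*n≤m⇒n≤↧δ*m : ∀ n m (δ : ℚ) → 0ℚ Q.< δ → δ Q.* ℕtoℚ n Q.≤ ℕtoℚ m → n ≤ ↧ₙ δ * m
δ*n≤m⇒n≤↧δ*m n m δ@(mkℚ ℤ.+[1+ s ] d _) _ δn≤m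
  with toℚᵘ-mono-≤-≃ δn≤m (ℚᵘ.≃-trans (toℚᵘ-homo-* δ (ℕtoℚ n)) (ℚᵘ.*-cong (ℚᵘ.≃-refl {toℚᵘ δ}) (toℚᵘ-/suc n 0)))
       (toℚᵘ-/suc m 0)
... | *≤* cross = begin
  n               ≤⟨ m≤m+n n (s * n) ⟩
  suc s * n       ≡⟨ *-identityʳ (suc s * n) ⟨
  suc s * n * 1   ≤⟨ +*+-cancel-≤ (suc s * n) 1 m (suc (d * 1)) cross′ ⟩
  m * suc (d * 1) ≡⟨ cong (λ t → m * suc t) (*-identityʳ d) ⟩
  m * suc d       ≡⟨ *-comm m (suc d) ⟩
  suc d * m       ∎
  where
  open ≤-Reasoning
  cross′ : ℤ.+ (suc s * n) ℤ.* ℤ.+ 1 ℤ.≤ ℤ.+ m ℤ.* ℤ.+ suc (d * 1)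
  cross′ = subst (λ t → t ℤ.* ℤ.+ 1 ℤ.≤ ℤ.+ m ℤ.* ℤ.+ suc (d * 1)) (+◃n≡+n (suc s * n)) cross
δ*n≤m⇒n≤↧δ*m n m (mkℚ ℤ.+0       _ _) (Q.*<* (ℤ.+<+ ())) _
δ*n≤m⇒n≤↧δ*m n m (mkℚ ℤ.-[1+ _ ] _ _) (Q.*<* ())        _

s≤n/[1+k]⇒[1+k]*s≤n : ∀ k n s → ℕtoℚ s Q.≤ (ℤ.+ 1) Q./ suc k Q.* ℕtoℚ n → suc k * s ≤ n
s≤n/[1+k]⇒[1+k]*s≤n k n s s≤n/[1+k]
  with toℚᵘ-mono-≤-≃ s≤n/[1+k] (toℚᵘ-/suc s 0)
         (ℚᵘ.≃-trans (toℚᵘ-homo-* ((ℤ.+ 1) Q./ suc k) (ℕtoℚ n)) (ℚᵘ.*-cong (toℚᵘ-/suc 1 k) (toℚᵘ-/suc n 0)))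
... | *≤* cross = begin
  suc k * s         ≡⟨ cong (λ t → suc t * s) (*-identityʳ k) ⟨
  suc (k * 1) * s   ≡⟨ *-comm (suc (k * 1)) s ⟩
  s * suc (k * 1)   ≤⟨ +*+-cancel-≤ s (suc (k * 1)) (n + 0) 1 cross′ ⟩
  (n + 0) * 1       ≡⟨ trans (*-identityʳ (n + 0)) (+-identityʳ n) ⟩
  n                 ∎
  where
  open ≤-Reasoning
  cross′ : ℤ.+ s ℤ.* ℤ.+ suc (k * 1) ℤ.≤ ℤ.+ (n + 0) ℤ.* ℤ.+ 1
  cross′ = subst (λ t → ℤ.+ s ℤ.* ℤ.+ suc (k * 1) ℤ.≤ t ℤ.* ℤ.+ 1) (+◃n≡+n (n + 0)) cross

n≤D*a⇒a*b≢0 : ∀ {n} D a b → 0 < n → n ≤ D * a → a ≡ b → NonZero (a * b)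
n≤D*a⇒a*b≢0 D a b 0<n n≤Da refl = m*n≢0 a a {{a≢0}} {{a≢0}}
  where
  a≢0 : NonZero a
  a≢0 = m*n≢0⇒n≢0 D {{>-nonZero (≤-trans 0<n n≤Da)}}

excess-density : ∀ R ℓ (μ : ℚ) e M .{{_ : NonZero M}} .{{_ : NonZero ℓ}} → 0ℚ Q.< μ →
  ratio R ℓ Q.+ μ Q.≤ ratio e M → (2 * ↧ₙ μ * R + 2) * M ≤ 2 * ↧ₙ μ * ℓ * e
excess-density R ℓ@(suc ℓ′) μ@(mkℚ ℤ.+[1+ s ] d _) e M@(suc k) _ R/ℓ+μ≤e/M
  with toℚᵘ-mono-≤-≃ R/ℓ+μ≤e/M
         (ℚᵘ.≃-trans (toℚᵘ-homo-+ (ratio R ℓ) μ) (ℚᵘ.+-cong (toℚᵘ-/suc R ℓ′) (ℚᵘ.≃-refl {toℚᵘ μ})))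
         (toℚᵘ-/suc e k)
... | *≤* cross = begin
  (2 * P * R + 2) * M         ≡⟨ factor-2 P R M ⟩
  2 * ((R * P + 1) * M)       ≤⟨ *-monoʳ-≤ 2 (*-monoˡ-≤ M (+-monoʳ-≤ (R * P) (s≤s z≤n))) ⟩
  2 * ((R * P + suc s * ℓ) * M) ≤⟨ *-monoʳ-≤ 2 (+*+-cancel-≤ (R * P + suc s * ℓ) M e (ℓ * P) cross′) ⟩
  2 * (e * (ℓ * P))           ≡⟨ unfactor-2 P ℓ e ⟩
  2 * P * ℓ * e               ∎
  where
  open ≤-Reasoning
  P = suc d
  cross′ : ℤ.+ (R * P + suc s * ℓ) ℤ.* ℤ.+ M ℤ.≤ ℤ.+ e ℤ.* ℤ.+ (ℓ * P)
  cross′ = subst (λ t → t ℤ.* ℤ.+ M ℤ.≤ ℤ.+ e ℤ.* ℤ.+ (ℓ * P))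
    (trans (cong (ℤ._+ ℤ.+ (suc s * ℓ)) (+◃n≡+n (R * P))) (sym (pos-+ (R * P) (suc s * ℓ)))) cross
  factor-2 : ∀ P R M → (2 * P * R + 2) * M ≡ 2 * ((R * P + 1) * M)
  factor-2 = solve-∀
  unfactor-2 : ∀ P ℓ e → 2 * (e * (ℓ * P)) ≡ 2 * P * ℓ * e
  unfactor-2 = solve-∀
excess-density R (suc _) (mkℚ ℤ.+0       _ _) e (suc _) (Q.*<* (ℤ.+<+ ())) _
excess-density R (suc _) (mkℚ ℤ.-[1+ _ ] _ _) e (suc _) (Q.*<* ())        _

2*n≤[1+k]*g⇒2n/[1+k]≤g : ∀ k n g → 2 * n ≤ suc k * g → (ℤ.+ 2) Q./ suc k Q.* ℕtoℚ n Q.≤ ℕtoℚ g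
2*n≤[1+k]*g⇒2n/[1+k]≤g k n g 2n≤[1+k]g = toℚᵘ-cancel-≤-≃
  (*≤* (subst (λ t → t ℤ.* ℤ.+ 1 ℤ.≤ ℤ.+ g ℤ.* ℤ.+ suc (k * 1)) (sym (+◃n≡+n (2 * n)))
    (+*+-mono-≤ (2 * n) 1 g (suc (k * 1)) (begin
      2 * n * 1       ≡⟨ *-identityʳ (2 * n) ⟩
      2 * n           ≤⟨ 2n≤[1+k]g ⟩
      suc k * g       ≡⟨ *-comm (suc k) g ⟩
      g * suc k       ≡⟨ cong (λ t → g * suc t) (*-identityʳ k) ⟨
      g * suc (k * 1) ∎))))
  (ℚᵘ.≃-trans (toℚᵘ-homo-* ((ℤ.+ 2) Q./ suc k) (ℕtoℚ n)) (ℚᵘ.*-cong (toℚᵘ-/suc 2 k) (toℚᵘ-/suc n 0)))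
  (toℚᵘ-/suc g 0)
  where open ≤-Reasoning

m≤n*[1+m/n] : ∀ m n .{{_ : NonZero n}} → m ≤ n * suc (m / n)
m≤n*[1+m/n] m n = begin
  m                   ≡⟨ m≡m%n+[m/n]*n m n ⟩
  m % n + m / n * n   ≤⟨ +-monoˡ-≤ (m / n * n) (<⇒≤ (m%n<n m n)) ⟩
  n + m / n * n       ≡⟨ cong (n +_) (*-comm (m / n) n) ⟩
  n + n * (m / n)     ≡⟨ *-suc n (m / n) ⟨
  n * suc (m / n)     ∎
  where open ≤-Reasoning

large-family : ∀ k n {A : Set} {P : List A → Set} →
  (∀ g → suc k * g ≤ 2 * n → Σ (List A) λ 𝒦 → length 𝒦 ≡ suc g × P 𝒦) →
  Σ (List A) λ 𝒦 → ((ℤ.+ 2) Q./ suc k Q.* ℕtoℚ n Q.≤ ℕtoℚ (length 𝒦)) × P 𝒦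
large-family k n family with family g (≤-trans (≤-reflexive (*-comm (suc k) g)) (m/n*n≤m (2 * n) (suc k)))
  where g = 2 * n / suc k
... | 𝒦 , ∣𝒦∣≡1+g , p𝒦 = 𝒦 , subst (λ t → (ℤ.+ 2) Q./ suc k Q.* ℕtoℚ n Q.≤ ℕtoℚ t) (sym ∣𝒦∣≡1+g)
  (2*n≤[1+k]*g⇒2n/[1+k]≤g k n (suc (2 * n / suc k)) (m≤n*[1+m/n] (2 * n) (suc k))) , p𝒦

-- Packing cliques across a dense pair

-- With m = |Vi| = |Vj|: `dense` says d(Vi, Vj) ≥ (r − ℓ)/ℓ + 2/(cℓ), `n≤D∣Vi∣` says m ≥ n/D,
-- and `α-bound` says α_ℓ(G) ≤ n/(A′ + 1).
module DensePair {n} (G : Graph n) {Vi Vj : Subset n} (Vi#Vj : Disjoint Vi Vj) (∣Vi∣≡∣Vj∣ : ∣ Vi ∣ ≡ ∣ Vj ∣)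
  {r ℓ x c D A′ : ℕ} .{{_ : NonZero ℓ}} (ℓ≤r : ℓ ≤ r) (x≤1 : x ≤ 1)
  (dense : (c * (r ∸ ℓ) + 2) * (∣ Vi ∣ * ∣ Vj ∣) ≤ c * ℓ * eCount G Vi Vj)
  (0<n : 0 < n) (n≤D∣Vi∣ : n ≤ D * ∣ Vi ∣) (A′-large : (2 * r + 2) * 2 ^ ℓ * (c * ℓ) * D ≤ A′)
  (α-bound : ∀ S → KFree G ℓ S → suc A′ * ∣ S ∣ ≤ n) where

  private
    R = r ∸ ℓ
    m = ∣ Vi ∣
    A = suc A′
    instance
      2^ℓ≢0 : NonZero (2 ^ ℓ)
      2^ℓ≢0 = m^n≢0 2 ℓ

  Good : Subset n → Set
  Good K = IsKr G r K × (∣ K ∩ Vi ∣ ≡ r ∸ ℓ + x) × (∣ K ∩ Vj ∣ ≡ ℓ ∸ x)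

  Budget : Subset n → Set
  Budget U = A * ∣ U ∣ ≤ r * (2 * n)

  large-outside : ∀ X U → m ≤ c * ℓ * ∣ X ∣ → Budget U → 2 ^ ℓ * (2 * n) ≤ A * ∣ X ∩ ∁ U ∣
  large-outside X U m≤cℓ∣X∣ budget = +-cancelʳ-≤ (r * (2 * n)) (2 ^ ℓ * (2 * n)) (A * ∣ X ∩ ∁ U ∣) (begin
    2 ^ ℓ * (2 * n) + r * (2 * n)              ≤⟨ +-monoʳ-≤ (2 ^ ℓ * (2 * n)) (m≤n*m (r * (2 * n)) (2 ^ ℓ)) ⟩
    2 ^ ℓ * (2 * n) + 2 ^ ℓ * (r * (2 * n))    ≡⟨ collect (2 ^ ℓ) r n ⟩
    (2 * r + 2) * 2 ^ ℓ * n                    ≤⟨ *-monoʳ-≤ ((2 * r + 2) * 2 ^ ℓ) (≤-trans n≤D∣Vi∣ (*-monoʳ-≤ D m≤cℓ∣X∣)) ⟩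
    (2 * r + 2) * 2 ^ ℓ * (D * (c * ℓ * ∣ X ∣)) ≡⟨ reassociate ((2 * r + 2) * 2 ^ ℓ) D (c * ℓ) ∣ X ∣ ⟩
    (2 * r + 2) * 2 ^ ℓ * (c * ℓ) * D * ∣ X ∣  ≤⟨ *-monoˡ-≤ ∣ X ∣ (≤-trans A′-large (n≤1+n A′)) ⟩
    A * ∣ X ∣                                  ≤⟨ *-monoʳ-≤ A (∣p∣≤∣p∩∁q∣+∣q∣ X U) ⟩
    A * (∣ X ∩ ∁ U ∣ + ∣ U ∣)                  ≡⟨ *-distribˡ-+ A ∣ X ∩ ∁ U ∣ ∣ U ∣ ⟩
    A * ∣ X ∩ ∁ U ∣ + A * ∣ U ∣                ≤⟨ +-monoʳ-≤ (A * ∣ X ∩ ∁ U ∣) budget ⟩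
    A * ∣ X ∩ ∁ U ∣ + r * (2 * n)              ∎)
    where
    open ≤-Reasoning
    collect : ∀ p r n → p * (2 * n) + p * (r * (2 * n)) ≡ (2 * r + 2) * p * n
    collect = solve-∀
    reassociate : ∀ a D b s → a * (D * (b * s)) ≡ a * b * D * s
    reassociate = solve-∀

  clique-in-large : ∀ S → 2 * n ≤ A * ∣ S ∣ → ∃ λ K → K ⊆ S × IsKr G ℓ K
  clique-in-large S 2n≤A∣S∣ = clique-in-nonfree G ℓ S λ free →
    <⇒≱ (<-≤-trans (m<m+n n (≤-trans 0<n (m≤m+n n 0))) 2n≤A∣S∣) (α-bound S free)

  clique-of-size : ∀ S → 2 * n ≤ A * ∣ S ∣ → ∀ k → k ≤ ℓ → ∃ λ Q → Q ⊆ S × ∣ Q ∣ ≡ k × Clique G Q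
  clique-of-size S 2n≤A∣S∣ k k≤ℓ with clique-in-large S 2n≤A∣S∣
  ... | K , K⊆S , ∣K∣≡ℓ , K-clique with ⊆-ofSize K (subst (k ≤_) (sym ∣K∣≡ℓ) k≤ℓ)
  ...   | Q , Q⊆K , ∣Q∣≡k = Q , K⊆S ∘ Q⊆K , ∣Q∣≡k , Clique-⊆ {G = G} Q⊆K K-clique

  High : Subset n
  High = Vi ∩ above ((c * R + 1) * m) (λ v → c * ℓ * ∣ Vj ∩ N G v ∣)

  CommonNeighbours : Subset n → Subset n
  CommonNeighbours C = Vj ∩ above R (λ w → ∣ C ∩ N G w ∣)

  ∈High⁻ : ∀ {v} → v ∈ High → (c * R + 1) * m < c * ℓ * ∣ Vj ∩ N G v ∣
  ∈High⁻ = ∈above⁻ {f = λ v → c * ℓ * ∣ Vj ∩ N G v ∣} ∘ proj₂ ∘ x∈p∩q⁻ Vi _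

  ∈CommonNeighbours⁻ : ∀ {C w} → w ∈ CommonNeighbours C → R < ∣ C ∩ N G w ∣
  ∈CommonNeighbours⁻ {C} = ∈above⁻ {f = λ w → ∣ C ∩ N G w ∣} ∘ proj₂ ∘ x∈p∩q⁻ Vj _

  high-clique : ∀ U → Budget U → ∃ λ C → C ⊆ High ∩ ∁ U × IsKr G ℓ C
  high-clique U budget = clique-in-large (High ∩ ∁ U) (≤-trans (m≤n*m (2 * n) (2 ^ ℓ))
    (large-outside High U (many-high-degree G Vi Vj c ℓ R refl (sym ∣Vi∣≡∣Vj∣) dense′) budget))
    where
    dense′ : (c * R + 2) * (m * m) ≤ c * ℓ * eCount G Vi Vj
    dense′ = subst (λ k → (c * R + 2) * (m * k) ≤ c * ℓ * eCount G Vi Vj) (sym ∣Vi∣≡∣Vj∣) dense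

  assemble : ∀ {U S T} → S ⊆ Vi ∩ ∁ U → T ⊆ Vj ∩ ∁ U → (∀ {w} → w ∈ T → S ⊆ N G w) →
    ∣ S ∣ ≡ R + x → Clique G S → (∃ λ Q → Q ⊆ T × ∣ Q ∣ ≡ ℓ ∸ x × Clique G Q) →
    ∃ λ K → Disjoint K U × Good K
  assemble {U} {S} S⊆Vi∖U T⊆Vj∖U S⊆N ∣S∣≡R+x S-clique (Q , Q⊆T , ∣Q∣≡ℓ∸x , Q-clique)
    with join-cliques {G = G} Vi#Vj
           (proj₁ ∘ x∈p∩q⁻ Vi (∁ U) ∘ S⊆Vi∖U) (proj₁ ∘ x∈p∩q⁻ Vj (∁ U) ∘ T⊆Vj∖U ∘ Q⊆T)
           S-clique Q-clique (λ u∈Q v∈S → ∈-tabulate⁻ (S⊆N (Q⊆T u∈Q) v∈S))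
  ... | (∣S∪Q∣≡ , S∪Q-clique) , S∪Q∩Vi≡S , S∪Q∩Vj≡Q =
    S ∪ Q , S∪Q#U ,
    (trans ∣S∪Q∣≡ (trans (cong₂ _+_ ∣S∣≡R+x ∣Q∣≡ℓ∸x) sizes-add-up) , S∪Q-clique) ,
    trans (cong ∣_∣ S∪Q∩Vi≡S) ∣S∣≡R+x ,
    trans (cong ∣_∣ S∪Q∩Vj≡Q) ∣Q∣≡ℓ∸x
    where
    Q⊆Vj∖U : Q ⊆ Vj ∩ ∁ U
    Q⊆Vj∖U = T⊆Vj∖U ∘ Q⊆T
    S∪Q#U : Disjoint (S ∪ Q) U
    S∪Q#U v∈S∪Q with x∈p∪q⁻ S Q v∈S∪Q
    ... | inj₁ v∈S = x∈∁p⇒x∉p (proj₂ (x∈p∩q⁻ Vi (∁ U) (S⊆Vi∖U v∈S)))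
    ... | inj₂ v∈Q = x∈∁p⇒x∉p (proj₂ (x∈p∩q⁻ Vj (∁ U) (Q⊆Vj∖U v∈Q)))
    sizes-add-up : R + x + (ℓ ∸ x) ≡ r
    sizes-add-up = begin
      R + x + (ℓ ∸ x)   ≡⟨ +-assoc R x (ℓ ∸ x) ⟩
      R + (x + (ℓ ∸ x)) ≡⟨ cong (R +_) (m+[n∸m]≡n (≤-trans x≤1 (>-nonZero⁻¹ ℓ))) ⟩
      R + ℓ             ≡⟨ m∸n+n≡m ℓ≤r ⟩
      r                 ∎
      where open ≡-Reasoning

  extend-clique : ∀ U → Budget U → (∃ λ C → C ⊆ High ∩ ∁ U × IsKr G ℓ C) →
    ∃ λ K → Disjoint K U × Good K
  extend-clique U budget (C , C⊆High∖U , ∣C∣≡ℓ , C-clique) =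
    assemble (∩-monoˡ-⊆ (p∩q⊆p Vi _) ∘ C⊆High∖U ∘ S⊆C) (∩-monoˡ-⊆ (p∩q⊆p Vj _) ∘ T′⊆T)
      (λ w∈T′ → p∩q⊆q C (N G _) ∘ S⊆F w∈T′)
      ∣S∣≡k (Clique-⊆ {G = G} S⊆C C-clique)
      (clique-of-size T′ 2n≤A∣T′∣ (ℓ ∸ x) (m∸n≤m ℓ x))
    where
    W′ = CommonNeighbours C ∩ ∁ U
    in-High∖U : ∀ {v} → v ∈ High ∩ ∁ U → v ∈ High × v ∈ ∁ U
    in-High∖U = x∈p∩q⁻ High (∁ U)
    in-W′ : ∀ {w} → w ∈ W′ → w ∈ CommonNeighbours C × w ∈ ∁ U
    in-W′ = x∈p∩q⁻ (CommonNeighbours C) (∁ U)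
    large-W′ : 2 ^ ℓ * (2 * n) ≤ A * ∣ W′ ∣
    large-W′ = large-outside (CommonNeighbours C) U
      (many-common-neighbours G Vj C c ℓ R (sym ∣Vi∣≡∣Vj∣) ∣C∣≡ℓ C-high) budget
      where
      C-high : ∀ {v} → v ∈ C → (c * R + 1) * m < c * ℓ * ∣ Vj ∩ N G v ∣
      C-high = ∈High⁻ ∘ proj₁ ∘ in-High∖U ∘ C⊆High∖U
    R+x≤∣C∩N∣ : ∀ {w} → w ∈ W′ → R + x ≤ ∣ C ∩ N G w ∣
    R+x≤∣C∩N∣ w∈W′ = ≤-trans (≤-trans (+-monoʳ-≤ R x≤1) (≤-reflexive (+-comm R 1)))
      (∈CommonNeighbours⁻ {C} (proj₁ (in-W′ w∈W′)))
    R+x≤∣C∣ : R + x ≤ ∣ C ∣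
    R+x≤∣C∣ with 0<∣p∣⇒Nonempty W′
                  (>-nonZero⁻¹ _ {{m*n≢0⇒n≢0 A {{>-nonZero (<-≤-trans 0<2^ℓ*2n large-W′)}}}})
      where
      0<2^ℓ*2n : 0 < 2 ^ ℓ * (2 * n)
      0<2^ℓ*2n = ≤-trans 0<n (≤-trans (m≤m+n n (n + 0)) (m≤n*m (2 * n) (2 ^ ℓ)))
    ... | w , w∈W′ = ≤-trans (R+x≤∣C∩N∣ w∈W′) (∣p∩q∣≤∣p∣ C (N G w))
    open CommonSubset
      (common-subset W′ (λ w → C ∩ N G w) C (R + x) (λ _ → p∩q⊆p C _) R+x≤∣C∩N∣ R+x≤∣C∣)
    2n≤A∣T′∣ : 2 * n ≤ A * ∣ T′ ∣
    2n≤A∣T′∣ = *-cancelˡ-≤ (2 ^ ℓ) (begin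
      2 ^ ℓ * (2 * n)          ≤⟨ large-W′ ⟩
      A * ∣ W′ ∣               ≤⟨ *-monoʳ-≤ A ∣T∣≤2^∣C∣*∣T′∣ ⟩
      A * (2 ^ ∣ C ∣ * ∣ T′ ∣) ≡⟨ cong (λ k → A * (2 ^ k * ∣ T′ ∣)) ∣C∣≡ℓ ⟩
      A * (2 ^ ℓ * ∣ T′ ∣)     ≡⟨ x∙yz≈y∙xz A (2 ^ ℓ) ∣ T′ ∣ ⟩
      2 ^ ℓ * (A * ∣ T′ ∣)     ∎)
      where open ≤-Reasoning

  avoiding-clique : ∀ U → Budget U → ∃ λ K → Disjoint K U × Good K
  avoiding-clique U budget = extend-clique U budget (high-clique U budget)

  disjoint-good-cliques : ∀ g → A * g ≤ 2 * n →
    Σ (List (Subset n)) λ 𝒦 → length 𝒦 ≡ suc g × AllPairs Disjoint 𝒦 × All Good 𝒦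
  disjoint-good-cliques g Ag≤2n =
    greedy-family (proj₁ ∘ proj₁) g (λ U ∣U∣≤rg → avoiding-clique U (budget {U} ∣U∣≤rg))
    where
    budget : ∀ {U} → ∣ U ∣ ≤ r * g → Budget U
    budget {U} ∣U∣≤rg = begin
      A * ∣ U ∣     ≤⟨ *-monoʳ-≤ A ∣U∣≤rg ⟩
      A * (r * g)   ≡⟨ x∙yz≈y∙xz A r g ⟩
      r * (A * g)   ≤⟨ *-monoʳ-≤ r Ag≤2n ⟩
      r * (2 * n)   ∎
      where open ≤-Reasoning

lemma6p3 : (r ℓ : ℕ) → ℓ ≤ r → r ≤ 2 * ℓ → 4 ≤ r →
    (ε μ δ : ℚ) → 0ℚ Q.< ℕtoℚ 4 Q.* ε → ℕtoℚ 4 Q.* ε Q.< μ → μ Q.< 1ℚ →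
    0ℚ Q.< δ → δ Q.< 1ℚ →
    Σ ℚ λ α → Σ ℚ λ γ → (0ℚ Q.< α) × (α Q.< γ) × Σ ℕ λ n₀ →
    ∀ n → n₀ ≤ n → (G : Graph n) → AlphaAtMost G ℓ (α Q.* ℕtoℚ n) →
    (Vi Vj : Subset n) → Disjoint Vi Vj → IsRegular G ε Vi Vj →
    ∣ Vi ∣ ≡ ∣ Vj ∣ → δ Q.* ℕtoℚ n Q.≤ ℕtoℚ ∣ Vi ∣ →
    ratio (r ∸ ℓ) ℓ Q.+ μ Q.≤ density G Vi Vj →
    (x : ℕ) → x ≤ 1 →
    Σ (List (Subset n)) λ 𝒦 →
      (γ Q.* ℕtoℚ n Q.≤ ℕtoℚ (length 𝒦)) ×
      AllPairs Disjoint 𝒦 ×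
      All (λ K → IsKr G r K × (∣ K ∩ Vi ∣ ≡ r ∸ ℓ + x) × (∣ K ∩ Vj ∣ ≡ ℓ ∸ x)) 𝒦
lemma6p3 r zero _ r≤2ℓ 4≤r = contradiction (≤-trans 4≤r r≤2ℓ) λ ()
lemma6p3 r ℓ@(suc _) ℓ≤r _ _ ε μ δ 0<4ε 4ε<μ _ 0<δ _ =
  (ℤ.+ 1) Q./ suc A′ , (ℤ.+ 2) Q./ suc A′ , 0<1/suc A′ , 1/suc<2/suc A′ , 1 ,
  λ n 0<n G α-bound Vi Vj Vi#Vj _ ∣Vi∣≡∣Vj∣ δn≤∣Vi∣ dense x x≤1 →
    let n≤D∣Vi∣ = δ*n≤m⇒n≤↧δ*m n ∣ Vi ∣ δ 0<δ δn≤∣Vi∣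
        instance
          ∣Vi∣*∣Vj∣≢0 : NonZero (∣ Vi ∣ * ∣ Vj ∣)
          ∣Vi∣*∣Vj∣≢0 = n≤D*a⇒a*b≢0 (↧ₙ δ) ∣ Vi ∣ ∣ Vj ∣ 0<n n≤D∣Vi∣ ∣Vi∣≡∣Vj∣
    in large-family A′ n
      (DensePair.disjoint-good-cliques G Vi#Vj ∣Vi∣≡∣Vj∣ {c = 2 * ↧ₙ μ} {↧ₙ δ} {A′} ℓ≤r x≤1
        (excess-density (r ∸ ℓ) ℓ μ (eCount G Vi Vj) (∣ Vi ∣ * ∣ Vj ∣) (ℚ.<-trans 0<4ε 4ε<μ) dense)
        0<n n≤D∣Vi∣ ≤-refl (λ S free → s≤n/[1+k]⇒[1+k]*s≤n A′ n ∣ S ∣ (α-bound S free)))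
  where
  -- μ ≥ 1/↧ₙ μ and δ ≥ 1/↧ₙ δ, so the denominators stand in for 1/μ and 1/δ.
  A′ = (2 * r + 2) * 2 ^ ℓ * (2 * ↧ₙ μ * ℓ) * ↧ₙ δ
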